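{- For every integer $n\ge 0$, the number $\mathrm{v}(n)$ is odd if and only if $n=2^{u}-1$ for some integer $u\geq 0$.
   Context: For a positive integer $n$, $\mathrm{v}(n)$ denotes the number of compositions (ordered partitions) of $n$ into powers of $2$, i.e. the number of finite sequences $(q_1,\ldots,q_\ell)$ of non-negative integers with $n=2^{q_1}+\cdots+2^{q_\ell}$. By convention $\mathrm{v}(0)=1$. -}

module Defs where

open import Data.Nat using (ℕ; zero; suc; _+_; _∸_; _^_; _≤ᵇ_)
open import Data.List using (List; []; _∷_; map; concatMap; upTo; length; filterᵇ)

-- comps fuel n : the list of ALL sequences (q₁,…,qₗ) of naturals with
-- 2^q₁ + ⋯ + 2^qₗ = n, provided fuel ≥ n (each part is ≥ 1, so n steps suffice;
-- exponents q with 2^q ≤ n satisfy q < n + 1).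
comps : ℕ → ℕ → List (List ℕ)
comps _        zero    = [] ∷ []
comps zero     (suc n) = []
comps (suc f)  (suc n) =
  concatMap (λ q → map (q ∷_) (comps f (suc n ∸ 2 ^ q)))
            (filterᵇ (λ q → 2 ^ q ≤ᵇ suc n) (upTo (suc (suc n))))

v : ℕ → ℕ
v n = length (comps n n)

{-# OPTIONS --safe #-}
module Submission where

-- Splitting off the first part gives v(N) = Σ_{2^q ≤ N} v(N − 2^q) for N ≥ 1. The number p(M) = pow₂Count M of
-- exponents r with 2^r = M satisfies the same recurrence modulo 2: Σ_q p(N + 1 − 2^q) counts the
-- ordered pairs (q, r) with 2^q + 2^r = N + 1, and the swap (q, r) ↦ (r, q) pairs these off except on
-- the diagonal 2^(q+1) = N + 1, which is counted by p(N + 1). Since v(0) = 1 = p(1), induction gives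
-- v(n) ≡ p(n + 1) (mod 2), and p(n + 1) is 1 or 0 according as n + 1 is a power of 2 or not.

open import Defs
open import Data.Nat using (ℕ; _^_; _∸_; _%_)
open import Data.Product using (∃-syntax)
open import Function.Bundles using (_⇔_)
open import Relation.Binary.PropositionalEquality using (_≡_)

open import Algebra.Properties.CommutativeSemigroup using (interchange)
open import Data.Bool using (Bool; true; false; if_then_else_)
open import Data.List using (List; _∷_; map; concatMap; filterᵇ; applyUpTo; length)
open import Data.List.Properties using (length-++; length-map)
open import Data.Nat using (zero; suc; _+_; _*_; _≤_; _<_; _≤ᵇ_; z≤n; s≤s; _≟_)
open import Data.Nat.DivMod using (%-distribˡ-+; [m+kn]%n≡m%n)
open import Data.Nat.Properties
open import Data.Nat.Solver using (module +-*-Solver)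
open import Data.Product using (_,_; map₂)
open import Function.Base using (_∘_)
open import Function.Bundles using (mk⇔)
open import Function.Definitions using (Injective)
open import Relation.Binary.Definitions using (tri<; tri≈; tri>)
open import Relation.Binary.PropositionalEquality
  using (_≢_; refl; sym; trans; cong; cong₂; module ≡-Reasoning)
open import Relation.Nullary using (yes; no; contradiction)
open import Relation.Nullary.Reflects using (ofʸ; ofⁿ)

∑< : ℕ → (ℕ → ℕ) → ℕ
∑< zero    f = 0
∑< (suc K) f = f 0 + ∑< K (λ i → f (suc i))

syntax ∑< K (λ i → f) = ∑[ i < K ] f

∑-cong : ∀ K {f g : ℕ → ℕ} → (∀ i → f i ≡ g i) → ∑< K f ≡ ∑< K g
∑-cong zero    f≡g = refl
∑-cong (suc K) f≡g = cong₂ _+_ (f≡g 0) (∑-cong K (λ i → f≡g (suc i)))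

∑-zero : ∀ K {f : ℕ → ℕ} → (∀ i → f i ≡ 0) → ∑< K f ≡ 0
∑-zero zero    f≡0 = refl
∑-zero (suc K) f≡0 = cong₂ _+_ (f≡0 0) (∑-zero K (λ i → f≡0 (suc i)))

∑-snoc : ∀ K (f : ℕ → ℕ) → ∑< (suc K) f ≡ ∑< K f + f K
∑-snoc zero    f = +-comm (f 0) 0
∑-snoc (suc K) f = trans (cong (f 0 +_) (∑-snoc K (λ i → f (suc i)))) (sym (+-assoc (f 0) _ _))

∑-+ : ∀ K (f g : ℕ → ℕ) → ∑[ i < K ] (f i + g i) ≡ ∑< K f + ∑< K g
∑-+ zero    f g = refl
∑-+ (suc K) f g = trans (cong (f 0 + g 0 +_) (∑-+ K (λ i → f (suc i)) (λ i → g (suc i))))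
  (interchange +-commutativeSemigroup (f 0) (g 0) _ _)

∑-split : ∀ K j (f : ℕ → ℕ) → ∑< (K + j) f ≡ ∑< K f + ∑[ i < j ] f (K + i)
∑-split zero    j f = refl
∑-split (suc K) j f = trans (cong (f 0 +_) (∑-split K j (λ i → f (suc i)))) (sym (+-assoc (f 0) _ _))

∑-extend : ∀ K K' (f : ℕ → ℕ) → K ≤ K' → (∀ i → K ≤ i → f i ≡ 0) → ∑< K' f ≡ ∑< K f
∑-extend K K' f K≤K' vanish = begin
  ∑< K' f                              ≡⟨ cong (λ k → ∑< k f) (sym (m+[n∸m]≡n K≤K')) ⟩
  ∑< (K + (K' ∸ K)) f                  ≡⟨ ∑-split K (K' ∸ K) f ⟩
  ∑< K f + ∑[ i < K' ∸ K ] f (K + i)   ≡⟨ cong (∑< K f +_) (∑-zero (K' ∸ K) (λ i → vanish (K + i) (m≤m+n K i))) ⟩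
  ∑< K f + 0                           ≡⟨ +-identityʳ _ ⟩
  ∑< K f                               ∎
  where open ≡-Reasoning

infix 4 _≡₂_

_≡₂_ : ℕ → ℕ → Set
a ≡₂ b = a % 2 ≡ b % 2

+-cong₂ : ∀ {a b c d} → a ≡₂ b → c ≡₂ d → a + c ≡₂ b + d
+-cong₂ {a} {b} {c} {d} a≡b c≡d = begin
  (a + c) % 2             ≡⟨ %-distribˡ-+ a c 2 ⟩
  (a % 2 + c % 2) % 2     ≡⟨ cong₂ (λ x y → (x + y) % 2) a≡b c≡d ⟩
  (b % 2 + d % 2) % 2     ≡⟨ %-distribˡ-+ b d 2 ⟨
  (b + d) % 2             ∎
  where open ≡-Reasoning

∑-cong₂ : ∀ K {f g : ℕ → ℕ} → (∀ i → f i ≡₂ g i) → ∑< K f ≡₂ ∑< K g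
∑-cong₂ zero    f≡g = refl
∑-cong₂ (suc K) {f} {g} f≡g =
  +-cong₂ {f 0} {g 0} {∑[ i < K ] f (suc i)} {∑[ i < K ] g (suc i)} (f≡g 0) (∑-cong₂ K (λ i → f≡g (suc i)))

∑∑-symmetric : ∀ K (F : ℕ → ℕ → ℕ) → (∀ q r → F q r ≡ F r q) →
  ∑[ q < K ] ∑< K (F q) ≡ ∑[ q < K ] F q q + 2 * ∑[ q < K ] ∑< q (F q)
∑∑-symmetric zero    F sym-F = refl
∑∑-symmetric (suc K) F sym-F = begin
  ∑[ q < suc K ] ∑< (suc K) (F q)
    ≡⟨ ∑-snoc K _ ⟩
  ∑[ q < K ] ∑< (suc K) (F q) + ∑< (suc K) (F K)
    ≡⟨ cong₂ _+_ (∑-cong K (λ q → ∑-snoc K (F q))) (∑-snoc K (F K)) ⟩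
  ∑[ q < K ] (∑< K (F q) + F q K) + (column + F K K)
    ≡⟨ cong (_+ (column + F K K)) (∑-+ K _ _) ⟩
  (∑[ q < K ] ∑< K (F q) + ∑[ q < K ] F q K) + (column + F K K)
    ≡⟨ cong₂ (λ x y → (x + y) + (column + F K K)) (∑∑-symmetric K F sym-F) (∑-cong K (λ q → sym-F q K)) ⟩
  (diagonal + 2 * lower + column) + (column + F K K)
    ≡⟨ solve 4 (λ d l a x → (d :+ con 2 :* l :+ a) :+ (a :+ x) := (d :+ x) :+ con 2 :* (l :+ a))
             refl diagonal lower column (F K K) ⟩
  (diagonal + F K K) + 2 * (lower + column)
    ≡⟨ cong₂ (λ x y → x + 2 * y) (∑-snoc K (λ q → F q q)) (∑-snoc K (λ q → ∑< q (F q))) ⟨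
  ∑[ q < suc K ] F q q + 2 * ∑[ q < suc K ] ∑< q (F q)
    ∎
  where
  open ≡-Reasoning
  open +-*-Solver
  diagonal = ∑[ q < K ] F q q
  lower    = ∑[ q < K ] ∑< q (F q)
  column   = ∑< K (F K)

∑∑-symmetric≡₂diagonal : ∀ K (F : ℕ → ℕ → ℕ) → (∀ q r → F q r ≡ F r q) →
  ∑[ q < K ] ∑< K (F q) ≡₂ ∑[ q < K ] F q q
∑∑-symmetric≡₂diagonal K F sym-F = begin
  (∑[ q < K ] ∑< K (F q)) % 2           ≡⟨ cong (_% 2) (∑∑-symmetric K F sym-F) ⟩
  (diagonal + 2 * lower) % 2            ≡⟨ cong (λ x → (diagonal + x) % 2) (*-comm 2 lower) ⟩
  (diagonal + lower * 2) % 2            ≡⟨ [m+kn]%n≡m%n diagonal lower 2 ⟩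
  diagonal % 2                          ∎
  where
  open ≡-Reasoning
  diagonal = ∑[ q < K ] F q q
  lower    = ∑[ q < K ] ∑< q (F q)

δ : ℕ → ℕ → ℕ
δ zero    zero    = 1
δ zero    (suc b) = 0
δ (suc a) zero    = 0
δ (suc a) (suc b) = δ a b

δ-refl : ∀ a → δ a a ≡ 1
δ-refl zero    = refl
δ-refl (suc a) = δ-refl a

δ-≢ : ∀ {a b} → a ≢ b → δ a b ≡ 0
δ-≢ {zero}  {zero}  a≢b = contradiction refl a≢b
δ-≢ {zero}  {suc b} a≢b = refl
δ-≢ {suc a} {zero}  a≢b = refl
δ-≢ {suc a} {suc b} a≢b = δ-≢ (a≢b ∘ cong suc)

δ-∸ : ∀ x y {M} → x ≤ M → δ y (M ∸ x) ≡ δ (x + y) M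
δ-∸ zero    y z≤n       = refl
δ-∸ (suc x) y (s≤s x≤M) = δ-∸ x y x≤M

∑δ≢0⇒∃ : ∀ K (g : ℕ → ℕ) M → ∑[ r < K ] δ (g r) M ≢ 0 → ∃[ r ] g r ≡ M
∑δ≢0⇒∃ zero    g M ∑≢0 = contradiction refl ∑≢0
∑δ≢0⇒∃ (suc K) g M ∑≢0 with g 0 ≟ M
... | yes g0≡M = 0 , g0≡M
... | no  g0≢M with ∑δ≢0⇒∃ K (λ i → g (suc i)) M (∑≢0 ∘ cong₂ _+_ (δ-≢ g0≢M))
...   | r , gr≡M = suc r , gr≡M

∑δ-injective : ∀ K {g : ℕ → ℕ} {M u} → Injective _≡_ _≡_ g → g u ≡ M → u < K →
  ∑[ r < K ] δ (g r) M ≡ 1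
∑δ-injective (suc K) {g} {u = zero} g-inj g0≡M _ = cong₂ _+_
  (trans (cong (δ (g 0)) (sym g0≡M)) (δ-refl (g 0)))
  (∑-zero K (λ i → δ-≢ (λ gi≡M → 1+n≢0 (g-inj (trans gi≡M (sym g0≡M))))))
∑δ-injective (suc K) {g} {u = suc u} g-inj gu≡M (s≤s u<K) = cong₂ _+_
  (δ-≢ (λ g0≡M → 1+n≢0 (g-inj (trans gu≡M (sym g0≡M)))))
  (∑δ-injective K (suc-injective ∘ g-inj) gu≡M u<K)

2^-injective : Injective _≡_ _≡_ (2 ^_)
2^-injective {a} {b} 2^a≡2^b with <-cmp a b
... | tri< a<b _ _ = contradiction 2^a≡2^b (<⇒≢ (^-monoʳ-< 2 ≤-refl a<b))
... | tri≈ _ a≡b _ = a≡b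
... | tri> _ _ b<a = contradiction (sym 2^a≡2^b) (<⇒≢ (^-monoʳ-< 2 ≤-refl b<a))

n<2^n : ∀ n → n < 2 ^ n
n<2^n zero    = s≤s z≤n
n<2^n (suc n) = +-mono-≤ (m^n>0 2 n) (≤-trans (n<2^n n) (m≤m+n (2 ^ n) 0))

pow₂Count : ℕ → ℕ
pow₂Count M = ∑[ r < M ] δ (2 ^ r) M

pow₂Count-extend : ∀ {M K} → M ≤ K → ∑[ r < K ] δ (2 ^ r) M ≡ pow₂Count M
pow₂Count-extend {M} {K} M≤K = ∑-extend M K (λ r → δ (2 ^ r) M) M≤K
  (λ r M≤r → δ-≢ (>⇒≢ (≤-<-trans M≤r (n<2^n r))))

pow₂Count-2^ : ∀ u → pow₂Count (2 ^ u) ≡ 1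
pow₂Count-2^ u = ∑δ-injective (2 ^ u) 2^-injective refl (n<2^n u)

pow₂Count≢0⇒∃ : ∀ M → pow₂Count M ≢ 0 → ∃[ u ] 2 ^ u ≡ M
pow₂Count≢0⇒∃ M = ∑δ≢0⇒∃ M (2 ^_) M

pow₂Count-∸ : ∀ x {M} → x ≤ M → pow₂Count (M ∸ x) ≡ ∑[ r < M ] δ (x + 2 ^ r) M
pow₂Count-∸ x {M} x≤M = trans (sym (pow₂Count-extend (m∸n≤m M x))) (∑-cong M (λ r → δ-∸ x (2 ^ r) x≤M))

∑δ-+2^-vanish : ∀ K x {M} → M ≤ x → ∑[ r < K ] δ (x + 2 ^ r) M ≡ 0
∑δ-+2^-vanish K x M≤x = ∑-zero K (λ r → δ-≢ (>⇒≢ (≤-<-trans M≤x (m<m+n x (m^n>0 2 r)))))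

length-concatMap-filterᵇ : ∀ (p : ℕ → Bool) (h : ℕ → List (List ℕ)) (g : ℕ → ℕ) K →
  length (concatMap (λ q → map (q ∷_) (h q)) (filterᵇ p (applyUpTo g K)))
    ≡ ∑[ i < K ] (if p (g i) then length (h (g i)) else 0)
length-concatMap-filterᵇ p h g zero    = refl
length-concatMap-filterᵇ p h g (suc K) with p (g 0)
... | true  = trans (length-++ (map (g 0 ∷_) (h (g 0))))
                    (cong₂ _+_ (length-map (g 0 ∷_) (h (g 0))) (length-concatMap-filterᵇ p h (g ∘ suc) K))
... | false = length-concatMap-filterᵇ p h (g ∘ suc) K

length-comps-suc : ∀ f m → length (comps (suc f) (suc m))
  ≡ ∑[ q < suc (suc m) ] (if 2 ^ q ≤ᵇ suc m then length (comps f (suc m ∸ 2 ^ q)) else 0)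
length-comps-suc f m =
  length-concatMap-filterᵇ (λ q → 2 ^ q ≤ᵇ suc m) (λ q → comps f (suc m ∸ 2 ^ q)) (λ q → q) (suc (suc m))

comps-parity : ∀ f n → n ≤ f → length (comps f n) ≡₂ pow₂Count (suc n)
comps-parity f       zero    _         = refl
comps-parity (suc f) (suc m) (s≤s m≤f) = begin
  length (comps (suc f) N) % 2
    ≡⟨ cong (_% 2) (length-comps-suc f m) ⟩
  (∑[ q < suc N ] onPowersBelow (length ∘ comps f) q) % 2
    ≡⟨ ∑-cong₂ (suc N) {onPowersBelow (length ∘ comps f)} {onPowersBelow (pow₂Count ∘ suc)} induction-hypothesis ⟩
  (∑[ q < suc N ] onPowersBelow (pow₂Count ∘ suc) q) % 2
    ≡⟨ cong (_% 2) (∑-cong (suc N) complement-count) ⟩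
  (∑[ q < suc N ] ∑[ r < suc N ] δ (2 ^ q + 2 ^ r) (suc N)) % 2
    ≡⟨ ∑∑-symmetric≡₂diagonal (suc N) (λ q r → δ (2 ^ q + 2 ^ r) (suc N))
                              (λ q r → cong (λ x → δ x (suc N)) (+-comm (2 ^ q) (2 ^ r))) ⟩
  (∑[ q < suc N ] δ (2 ^ q + 2 ^ q) (suc N)) % 2
    ≡⟨ cong (_% 2) diagonal ⟩
  pow₂Count (suc N) % 2
    ∎
  where
  open ≡-Reasoning
  N = suc m

  onPowersBelow : (ℕ → ℕ) → ℕ → ℕ
  onPowersBelow h q = if 2 ^ q ≤ᵇ N then h (N ∸ 2 ^ q) else 0

  induction-hypothesis : ∀ q → onPowersBelow (length ∘ comps f) q ≡₂ onPowersBelow (pow₂Count ∘ suc) q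
  induction-hypothesis q with 2 ^ q ≤ᵇ N | ≤ᵇ-reflects-≤ (2 ^ q) N
  ... | true  | ofʸ _     = comps-parity f (N ∸ 2 ^ q) (≤-trans (∸-monoʳ-≤ N (m^n>0 2 q)) m≤f)
  ... | false | ofⁿ _     = refl

  complement-count : ∀ q → onPowersBelow (pow₂Count ∘ suc) q ≡ ∑[ r < suc N ] δ (2 ^ q + 2 ^ r) (suc N)
  complement-count q with 2 ^ q ≤ᵇ N | ≤ᵇ-reflects-≤ (2 ^ q) N
  ... | true  | ofʸ 2^q≤N = trans (cong pow₂Count (sym (+-∸-assoc 1 2^q≤N))) (pow₂Count-∸ (2 ^ q) (m≤n⇒m≤1+n 2^q≤N))
  ... | false | ofⁿ 2^q≰N = sym (∑δ-+2^-vanish (suc N) (2 ^ q) (≰⇒> 2^q≰N))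

  -- The r = 0 term δ 1 (suc N) of the extended count vanishes because N ≥ 1.
  diagonal : ∑[ q < suc N ] δ (2 ^ q + 2 ^ q) (suc N) ≡ pow₂Count (suc N)
  diagonal = trans (∑-cong (suc N) (λ q → cong (λ x → δ (2 ^ q + x) (suc N)) (sym (+-identityʳ (2 ^ q)))))
                   (pow₂Count-extend (n≤1+n (suc N)))

v-parity : ∀ n → v n % 2 ≡ pow₂Count (suc n) % 2
v-parity n = comps-parity n n ≤-refl

proposition1 : (n : ℕ) → (v n % 2 ≡ 1) ⇔ (∃[ u ] n ≡ 2 ^ u ∸ 1)
proposition1 n = mk⇔ odd⇒pow₂ pow₂⇒odd
  where
  odd⇒pow₂ : v n % 2 ≡ 1 → ∃[ u ] n ≡ 2 ^ u ∸ 1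
  odd⇒pow₂ v-odd = map₂ (cong (_∸ 1) ∘ sym) (pow₂Count≢0⇒∃ (suc n) count≢0)
    where
    count≢0 : pow₂Count (suc n) ≢ 0
    count≢0 count≡0 = 0≢1+n (trans (cong (_% 2) (sym count≡0)) (trans (sym (v-parity n)) v-odd))

  pow₂⇒odd : ∃[ u ] n ≡ 2 ^ u ∸ 1 → v n % 2 ≡ 1
  pow₂⇒odd (u , n≡2^u∸1) = begin
    v n % 2                ≡⟨ v-parity n ⟩
    pow₂Count (suc n) % 2  ≡⟨ cong (λ m → pow₂Count m % 2) 1+n≡2^u ⟩
    pow₂Count (2 ^ u) % 2  ≡⟨ cong (_% 2) (pow₂Count-2^ u) ⟩
    1                      ∎
    where
    open ≡-Reasoning
    1+n≡2^u : suc n ≡ 2 ^ u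
    1+n≡2^u = trans (cong suc n≡2^u∸1) (suc-pred (2 ^ u) {{m^n≢0 2 u}})
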